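{- Let $s\ge1$, $t\ge 2$, $G\in\mathcal{G}_{s,t}$ with root $r$, and let $C$ be a non-trivial configuration with $k$ pebble-free vertices in $S$. If $k$ is odd and $C_T\ge k+1$, then Mover has a winning strategy.
   Context: A configuration $C$ on a graph $G$ is a function $C:V(G)\to\mathbb{Z}_{\ge 0}$. A pebbling move removes two pebbles from a vertex and places one pebble on an adjacent vertex. The Two-Player Pebbling Game on $G$ with root $r$ and starting configuration $C$ is played by Mover and Defender in rounds: in each round Mover makes a pebbling move and then Defender makes a pebbling move; each player must take their turn. If Mover pebbles from $u$ to $v$, Defender may not pebble from $v$ to $u$ in the same round. Mover wins if at any time the root has at least one pebble; Defender wins if the root has no pebble and there are no more pebbling moves. A winning strategy is a rule choosing a player's moves as a function of the current position which guarantees that player wins. For integers $s,t\ge1$, $\mathcal{G}_{s,t}$ is the class of all graphs $(K_1\cup \overline{K_t})\vee H$, where $H$ is any graph on $s$ vertices, $\overline{K_t}$ is the edgeless graph on $t$ vertices, $\cup$ is disjoint union and $\vee$ is the join. The root $r$ is the vertex of $K_1$; $S=V(H)$, $T=V(\overline{K_t})$. A configuration is non-trivial if each vertex of $S$ has 0 or 1 pebbles and the root has no pebbles. A vertex is pebble-free if it has no pebbles. $k$ is the number of pebble-free vertices of $S$, and $C_T=\sum_{v\in T}\lfloor C(v)/2\rfloor$. -}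

module Defs where

open import Data.Nat using (ℕ; zero; suc; _+_; _∸_; _≤_; ⌊_/2⌋)
open import Data.Fin using (Fin)
import Data.Fin as F
open import Data.Bool using (Bool; true; false)
open import Data.Product using (_×_; Σ; ∃; _,_)
open import Data.Sum using (_⊎_)
open import Relation.Nullary using (¬_; Dec; yes; no)
open import Relation.Binary.PropositionalEquality using (_≡_; refl; cong)

record SimpleGraph (s : ℕ) : Set where
  field
    adj    : Fin s → Fin s → Bool
    sym    : ∀ i j → adj i j ≡ adj j i
    irrefl : ∀ i → adj i i ≡ false
open SimpleGraph public

-- Vertices of (K₁ ∪ K̄_t) ∨ H : the root r, the vertices of S = V(H), the vertices of T.
data Vtx (s t : ℕ) : Set where
  root : Vtx s t
  sv   : Fin s → Vtx s t
  tv   : Fin t → Vtx s t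

data Adj {s t : ℕ} (H : SimpleGraph s) : Vtx s t → Vtx s t → Set where
  r-S : ∀ i → Adj H root (sv i)
  S-r : ∀ i → Adj H (sv i) root
  S-T : ∀ i j → Adj H (sv i) (tv j)
  T-S : ∀ j i → Adj H (tv j) (sv i)
  S-S : ∀ i j → adj H i j ≡ true → Adj H (sv i) (sv j)

_≟V_ : ∀ {s t} (x y : Vtx s t) → Dec (x ≡ y)
root ≟V root = yes refl
root ≟V sv _ = no (λ ())
root ≟V tv _ = no (λ ())
sv _ ≟V root = no (λ ())
sv i ≟V sv j with i F.≟ j
... | yes refl = yes refl
... | no ne = no (λ { refl → ne refl })
sv _ ≟V tv _ = no (λ ())
tv _ ≟V root = no (λ ())
tv _ ≟V sv _ = no (λ ())
tv i ≟V tv j with i F.≟ j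
... | yes refl = yes refl
... | no ne = no (λ { refl → ne refl })

Config : ℕ → ℕ → Set
Config s t = Vtx s t → ℕ

step : ∀ {s t} → Config s t → Vtx s t → Vtx s t → Config s t
step C u v w with w ≟V u
... | yes _ = C w ∸ 2
... | no _ with w ≟V v
...   | yes _ = suc (C w)
...   | no _  = C w

Legal : ∀ {s t} (H : SimpleGraph s) → Config s t → Vtx s t → Vtx s t → Set
Legal H C u v = Adj H u v × 2 ≤ C u

DefLegal : ∀ {s t} (H : SimpleGraph s) → Config s t → Vtx s t → Vtx s t
         → Vtx s t → Vtx s t → Set
DefLegal H C u v x y = Legal H C x y × ¬ (x ≡ v × y ≡ u)

-- MoverWins H C : Mover, about to move at the start of a round in position C,
-- has a winning strategy.  (The game is finite: every move lowers the total
-- number of pebbles, so the inductive game-tree characterisation is exactly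
-- existence of a winning strategy.)  Mover wins as soon as the root holds a
-- pebble; if the root is empty and the player to move has no legal move,
-- Defender wins.
data MoverWins {s t : ℕ} (H : SimpleGraph s) : Config s t → Set where
  rootPebbled : ∀ {C} → 1 ≤ C root → MoverWins H C
  play : ∀ {C} (u v : Vtx s t) → Legal H C u v →
         ( 1 ≤ step C u v root
         ⊎ ( (Σ (Vtx s t) λ x → Σ (Vtx s t) λ y → DefLegal H (step C u v) u v x y)
           × (∀ x y → DefLegal H (step C u v) u v x y → MoverWins H (step (step C u v) x y)) ) )
         → MoverWins H C

sumFin : (n : ℕ) → (Fin n → ℕ) → ℕ
sumFin zero    f = 0
sumFin (suc n) f = f F.zero + sumFin n (λ i → f (F.suc i))

NonTrivial : ∀ {s t} → Config s t → Set
NonTrivial {s} C = C root ≡ 0 × (∀ (i : Fin s) → C (sv i) ≤ 1)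

isZero : ℕ → ℕ
isZero zero    = 1
isZero (suc _) = 0

kFree : ∀ {s t} → Config s t → ℕ
kFree {s} C = sumFin s (λ i → isZero (C (sv i)))

CT : ∀ {s t} → Config s t → ℕ
CT {t = t} C = sumFin t (λ j → ⌊ C (tv j) /2⌋)

Odd : ℕ → Set
Odd n = Σ ℕ λ m → n ≡ suc (m + m)

module Submission where

-- Mover's strategy is: always pebble from a vertex of T holding
-- at least two pebbles onto a pebble-free vertex of S.  In a non-trivial
-- configuration every vertex of S holds at most one pebble and the root none,
-- so the only legal moves are from T to S (T is adjacent to S only).  Hence
-- after Mover's move, Defender must pebble some T-vertex onto some S-vertex:
--   * if that S-vertex already had a pebble it now has two, and Mover moves
--     one of them to the root and wins;
--   * otherwise Defender filled a hole, and the round has lowered both k and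
--     C_T by exactly two, so the position is again non-trivial with k odd
--     and C_T ≥ k + 1.
-- When k = 1, Mover fills the last hole, so Defender can no longer fill one.
-- The inequality C_T ≥ k + 1 guarantees that Mover has a move and that
-- Defender still has a move afterwards (as the rules require).

open import Defs hiding (sym)
open import Data.Nat using (ℕ; zero; suc; _+_; _∸_; _≤_; ⌊_/2⌋; z≤n; s≤s)
open import Data.Nat.Properties using (+-suc; suc-injective; ≤-reflexive; ≤-trans; ≤-pred)
open import Data.Fin using (Fin)
import Data.Fin as F
open import Data.Product using (Σ; _×_; _,_; proj₁; proj₂)
open import Data.Sum using (inj₁; inj₂)
open import Data.Empty using (⊥-elim)
open import Relation.Nullary using (¬_; Dec; yes; no)
open import Relation.Binary.PropositionalEquality
  using (_≡_; refl; sym; trans; cong; cong₂; subst; subst₂; module ≡-Reasoning)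

step-src : ∀ {s t} (C : Config s t) u v → step C u v u ≡ C u ∸ 2
step-src C u v with u ≟V u
... | yes _ = refl
... | no u≢u = ⊥-elim (u≢u refl)

step-tgt : ∀ {s t} (C : Config s t) u v → ¬ v ≡ u → step C u v v ≡ suc (C v)
step-tgt C u v v≢u with v ≟V u
... | yes v≡u = ⊥-elim (v≢u v≡u)
... | no _ with v ≟V v
...   | yes _ = refl
...   | no v≢v = ⊥-elim (v≢v refl)

step-other : ∀ {s t} (C : Config s t) u v w → ¬ w ≡ u → ¬ w ≡ v → step C u v w ≡ C w
step-other C u v w w≢u w≢v with w ≟V u
... | yes w≡u = ⊥-elim (w≢u w≡u)
... | no _ with w ≟V v
...   | yes w≡v = ⊥-elim (w≢v w≡v)
...   | no _ = refl

sv-injective : ∀ {s t} {a b : Fin s} → sv {s} {t} a ≡ sv b → a ≡ b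
sv-injective refl = refl

tv-injective : ∀ {s t} {a b : Fin t} → tv {s} {t} a ≡ tv b → a ≡ b
tv-injective refl = refl

sumFin-ext : ∀ n (f g : Fin n → ℕ) → (∀ j → f j ≡ g j) → sumFin n f ≡ sumFin n g
sumFin-ext zero    f g f≗g = refl
sumFin-ext (suc n) f g f≗g =
  cong₂ _+_ (f≗g F.zero) (sumFin-ext n _ _ (λ j → f≗g (F.suc j)))

sumFin-suc-at : ∀ n (f g : Fin n → ℕ) i → f i ≡ suc (g i)
  → (∀ j → ¬ j ≡ i → f j ≡ g j) → sumFin n f ≡ suc (sumFin n g)
sumFin-suc-at (suc n) f g F.zero fi gj
  rewrite fi | sumFin-ext n _ _ (λ j → gj (F.suc j) (λ ())) = refl
sumFin-suc-at (suc n) f g (F.suc i) fi gj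
  rewrite gj F.zero (λ ())
        | sumFin-suc-at n _ _ i fi (λ j j≢i → gj (F.suc j) (λ { refl → j≢i refl }))
  = +-suc (g F.zero) _

sumFin-pos : ∀ n (f : Fin n → ℕ) → 1 ≤ sumFin n f → Σ (Fin n) λ i → 1 ≤ f i
sumFin-pos (suc n) f pos with f F.zero in eq
... | zero  = let (i , fi) = sumFin-pos n _ pos in F.suc i , fi
... | suc _ = F.zero , subst (1 ≤_) (sym eq) (s≤s z≤n)

isZero-pos : ∀ c → 1 ≤ isZero c → c ≡ 0
isZero-pos zero _ = refl

half-pos : ∀ c → 1 ≤ ⌊ c /2⌋ → 2 ≤ c
half-pos (suc (suc c)) _ = s≤s (s≤s z≤n)

half-minus-two : ∀ c → 2 ≤ c → ⌊ c /2⌋ ≡ suc ⌊ c ∸ 2 /2⌋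
half-minus-two (suc (suc c)) _ = refl
half-minus-two (suc zero) (s≤s ())

findHole : ∀ {s t} (C : Config s t) → 1 ≤ kFree C → Σ (Fin s) λ i → C (sv i) ≡ 0
findHole {s} C k≥1 =
  let (i , hole) = sumFin-pos s _ k≥1 in i , isZero-pos _ hole

findHeap : ∀ {s t} (C : Config s t) → 1 ≤ CT C → Σ (Fin t) λ j → 2 ≤ C (tv j)
findHeap {t = t} C ct≥1 =
  let (j , heap) = sumFin-pos t _ ct≥1 in j , half-pos _ heap

two≰one : ∀ {n} → 2 ≤ n → ¬ n ≤ 1
two≰one (s≤s (s≤s _)) (s≤s ())

legal-T→S : ∀ {s t} {H : SimpleGraph s} {C : Config s t} {x y} → NonTrivial C
  → Legal H C x y → Σ (Fin t) λ j → Σ (Fin s) λ i → x ≡ tv j × y ≡ sv i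
legal-T→S _          (T-S j i , _)     = j , i , refl , refl
legal-T→S (r0 , _)   (r-S _ , two)     = ⊥-elim (two≰one two (subst (_≤ 1) (sym r0) z≤n))
legal-T→S (_ , S≤1)  (S-r i , two)     = ⊥-elim (two≰one two (S≤1 i))
legal-T→S (_ , S≤1)  (S-T i _ , two)   = ⊥-elim (two≰one two (S≤1 i))
legal-T→S (_ , S≤1)  (S-S i _ _ , two) = ⊥-elim (two≰one two (S≤1 i))

fill-nonTrivial : ∀ {s t} (C : Config s t) j i → C (sv i) ≡ 0
  → NonTrivial C → NonTrivial (step C (tv j) (sv i))
fill-nonTrivial C j i hole (r0 , S≤1) =
  trans (step-other C (tv j) (sv i) root (λ ()) (λ ())) r0 , S≤1′
  where
  S≤1′ : ∀ i′ → step C (tv j) (sv i) (sv i′) ≤ 1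
  S≤1′ i′ = by-cases (i′ F.≟ i)
    where
    by-cases : Dec (i′ ≡ i) → step C (tv j) (sv i) (sv i′) ≤ 1
    by-cases (yes refl) = ≤-reflexive (trans (step-tgt C (tv j) (sv i) (λ ())) (cong suc hole))
    by-cases (no i′≢i)  = subst (_≤ 1)
      (sym (step-other C (tv j) (sv i) (sv i′) (λ ()) (λ e → i′≢i (sv-injective e))))
      (S≤1 i′)

fill-kFree : ∀ {s t} (C : Config s t) j i → C (sv i) ≡ 0
  → kFree C ≡ suc (kFree (step C (tv j) (sv i)))
fill-kFree {s} C j i hole = sumFin-suc-at s _ _ i hole-filled
  (λ i′ i′≢i → sym (cong isZero
     (step-other C (tv j) (sv i) (sv i′) (λ ()) (λ e → i′≢i (sv-injective e)))))
  where
  hole-filled : isZero (C (sv i)) ≡ suc (isZero (step C (tv j) (sv i) (sv i)))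
  hole-filled rewrite step-tgt C (tv j) (sv i) (λ ()) | hole = refl

fill-CT : ∀ {s t} (C : Config s t) j i → 2 ≤ C (tv j)
  → CT C ≡ suc (CT (step C (tv j) (sv i)))
fill-CT {t = t} C j i heap = sumFin-suc-at t _ _ j heap-used
  (λ j′ j′≢j → sym (cong ⌊_/2⌋
     (step-other C (tv j) (sv i) (tv j′) (λ e → j′≢j (tv-injective e)) (λ ()))))
  where
  heap-used : ⌊ C (tv j) /2⌋ ≡ suc ⌊ step C (tv j) (sv i) (tv j) /2⌋
  heap-used rewrite step-src C (tv j) (sv i) = half-minus-two _ heap

doubled-wins : ∀ {s t} (H : SimpleGraph s) (C : Config s t) i → 2 ≤ C (sv i)
  → MoverWins H C
doubled-wins H C i two = play (sv i) root (S-r i , two)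
  (inj₁ (subst (1 ≤_) (sym (step-tgt C (sv i) root (λ ()))) (s≤s z≤n)))

-- WinsAfterRound H C: Mover wins from every non-trivial configuration in
-- which both k and C_T are two smaller than in C, i.e. from every outcome of
-- a round starting at C in which both players fill a hole of S.

WinsAfterRound : ∀ {s t} → SimpleGraph s → Config s t → Set
WinsAfterRound {s} {t} H C = ∀ (D : Config s t) → NonTrivial D
  → kFree C ≡ suc (suc (kFree D)) → CT C ≡ suc (suc (CT D)) → MoverWins H D

round : ∀ {s t} (H : SimpleGraph s) (C : Config s t) → NonTrivial C
  → 1 ≤ kFree C → suc (kFree C) ≤ CT C → WinsAfterRound H C
  → MoverWins H C
round {s} {t} H C nt k≥1 k<CT next =
  play (tv j) (sv i) (T-S j i , heap) (inj₂ (defender-can-move , respond))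
  where
  hole-i : Σ (Fin s) λ i → C (sv i) ≡ 0
  hole-i = findHole C k≥1
  i : Fin s
  i = proj₁ hole-i
  hole : C (sv i) ≡ 0
  hole = proj₂ hole-i

  heap-j : Σ (Fin t) λ j → 2 ≤ C (tv j)
  heap-j = findHeap C (≤-trans (s≤s z≤n) k<CT)
  j : Fin t
  j = proj₁ heap-j
  heap : 2 ≤ C (tv j)
  heap = proj₂ heap-j

  C′ : Config s t
  C′ = step C (tv j) (sv i)

  nt′ : NonTrivial C′
  nt′ = fill-nonTrivial C j i hole nt

  -- C_T(C′) = C_T(C) - 1 ≥ k ≥ 1, so a heap remains in T for Defender.
  CT′≥1 : 1 ≤ CT C′
  CT′≥1 = ≤-trans k≥1 (≤-pred (subst (suc (kFree C) ≤_) (fill-CT C j i heap) k<CT))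

  -- Defender may pebble onto sv i: that is not the reverse of Mover's move.
  defender-can-move : Σ (Vtx s t) λ x → Σ (Vtx s t) λ y → DefLegal H C′ (tv j) (sv i) x y
  defender-can-move =
    let (j′ , heap′) = findHeap C′ CT′≥1
    in tv j′ , sv i , (T-S j′ i , heap′) , λ { (() , _) }

  respond : ∀ x y → DefLegal H C′ (tv j) (sv i) x y → MoverWins H (step C′ x y)
  respond x y (legal , _) with legal-T→S {C = C′} nt′ legal
  ... | j″ , i″ , refl , refl with C′ (sv i″) in occupied
  ...   | suc _ = doubled-wins H _ i″
          (subst (2 ≤_) (sym (trans (step-tgt C′ (tv j″) (sv i″) (λ ())) (cong suc occupied)))
                 (s≤s (s≤s z≤n)))
  ...   | zero  = next _ (fill-nonTrivial C′ j″ i″ occupied nt′)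
          (trans (fill-kFree C j i hole) (cong suc (fill-kFree C′ j″ i″ occupied)))
          (trans (fill-CT C j i heap) (cong suc (fill-CT C′ j″ i″ (proj₂ legal))))

-- For m = 0 Defender cannot fill a second
-- hole; otherwise a round leads to the same situation with m - 1.

odd-wins : ∀ {s t} (H : SimpleGraph s) m (C : Config s t) → NonTrivial C
  → kFree C ≡ suc (m + m) → suc (kFree C) ≤ CT C → MoverWins H C
odd-wins H zero C nt k≡1 k<CT =
  round H C nt (≤-reflexive (sym k≡1)) k<CT no-second-hole
  where
  no-second-hole : WinsAfterRound H C
  no-second-hole D _ k≡ _ with trans (sym k≡1) k≡
  ... | ()
odd-wins H (suc m) C nt k≡odd k<CT =
  round H C nt (subst (1 ≤_) (sym k≡odd) (s≤s z≤n)) k<CT continue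
  where
  continue : WinsAfterRound H C
  continue D ntD k≡ ct≡ = odd-wins H m D ntD kD≡odd kD<CTD
    where
    kD≡odd : kFree D ≡ suc (m + m)
    kD≡odd = suc-injective (suc-injective (begin
      suc (suc (kFree D))    ≡⟨ sym k≡ ⟩
      kFree C                ≡⟨ k≡odd ⟩
      suc (suc m + suc m)    ≡⟨ cong (λ n → suc (suc n)) (+-suc m m) ⟩
      suc (suc (suc (m + m))) ∎))
      where open ≡-Reasoning
    kD<CTD : suc (kFree D) ≤ CT D
    kD<CTD = ≤-pred (≤-pred (subst₂ (λ a b → suc a ≤ b) k≡ ct≡ k<CT))

-- The theorem.

lemma3p4 : (s t : ℕ) → 1 ≤ s → 2 ≤ t → (H : SimpleGraph s) → (C : Config s t)
    → NonTrivial C → Odd (kFree C) → suc (kFree C) ≤ CT C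
    → MoverWins H C
lemma3p4 s t _ _ H C nt (m , k≡odd) k<CT = odd-wins H m C nt k≡odd k<CT
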